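{- Let $B$ be a bipartite graph with vertex classes $\mathcal{R}$ and $W$ which has a matching saturating $\mathcal{R}$. Then $W$ contains a unique (inclusion-)maximal essential subset.
   Context: For a bipartite graph with vertex classes $X_1$ and $X_2$, a subset $C\subseteq X_i$ is called essential if there is a subset $U\subseteq X_{3-i}$ with $|U|=|C|$ and $C=N(U)$, where $N(U)$ denotes the set of vertices adjacent to some vertex of $U$. -}

module Defs where

open import Data.Nat using (ℕ)
open import Data.Bool using (Bool; true)
open import Data.Fin using (Fin)
open import Data.Fin.Subset using (Subset; _∈_; _⊆_; _⊂_; ∣_∣)
open import Data.Product using (Σ; ∃; ∃-syntax; _×_; _,_)
open import Relation.Binary.PropositionalEquality using (_≡_)
open import Function.Definitions using (Injective)
open import Function.Bundles using (_⇔_)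
open import Relation.Nullary using (¬_)

record BipGraph (m n : ℕ) : Set where
  field
    adj : Fin m → Fin n → Bool
open BipGraph public

Adj : ∀ {m n} → BipGraph m n → Fin m → Fin n → Set
Adj B i j = adj B i j ≡ true

IsNbhd₁ : ∀ {m n} → BipGraph m n → Subset m → Subset n → Set
IsNbhd₁ B U C = ∀ j → (j ∈ C) ⇔ (∃[ i ] (i ∈ U × Adj B i j))

-- C ⊆ X₂ (here X₂ = W) is essential: there is U ⊆ X₁ with |U| = |C|, C = N(U).
Essential₂ : ∀ {m n} → BipGraph m n → Subset n → Set
Essential₂ B C = ∃[ U ] (∣ U ∣ ≡ ∣ C ∣ × IsNbhd₁ B U C)

MaximalEssential₂ : ∀ {m n} → BipGraph m n → Subset n → Set
MaximalEssential₂ B C = Essential₂ B C × (∀ C′ → Essential₂ B C′ → ¬ (C ⊂ C′))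

HasMatchingSaturating₁ : ∀ {m n} → BipGraph m n → Set
HasMatchingSaturating₁ {m} {n} B =
  ∃[ f ] (Injective _≡_ _≡_ f × (∀ (i : Fin m) → Adj B i (f i)))

-- Let f be the matching. If C = N(U) then f(U) ⊆ C, so |U| ≤ |C| by injectivity;
-- likewise f(U₁ ∩ U₂) ⊆ C₁ ∩ C₂ when C₁ = N(U₁) and C₂ = N(U₂). As
-- C₁ ∪ C₂ = N(U₁ ∪ U₂), inclusion–exclusion turns |U₁ ∩ U₂| ≤ |C₁ ∩ C₂| into
-- |C₁ ∪ C₂| ≤ |U₁ ∪ U₂|, so essential sets are closed under union. The empty set
-- is essential, hence maximal essential sets exist, and two maximal ones both
-- equal their union.
module Submission where

open import Defs
open import Data.Nat using (suc; _+_; _≤_; _≟_; s≤s; z≤n)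
open import Data.Nat.Properties
  using (≤-trans; ≤-antisym; +-suc; +-monoʳ-≤; +-cancelʳ-≤; module ≤-Reasoning)
open import Data.Bool using (true)
import Data.Bool.Properties as Bool
open import Data.Fin using (Fin)
open import Data.Fin.Properties using (any?; all?; suc-injective)
open import Data.Fin.Subset
  using (Subset; _∈_; _⊆_; _⊂_; _⊃_; ∣_∣; _∪_; _∩_; _-_; ⊥; inside; outside)
open import Data.Fin.Subset.Properties
  using ( _∈?_; _⊂?_; anySubset?; ⊆-antisym; ∉⊥; ∣⊥∣≡0; ∪-comm
        ; p⊆p∪q; q⊆p∪q; x∈p∪q⁻; x∈p∩q⁻; x∈p∩q⁺
        ; x∈p∧x≢y⇒x∈p-y; x∈p⇒∣p-x∣<∣p∣; ∣p─q∣≤∣p∣ )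
open import Data.Fin.Subset.Induction using (Acc; acc; ⊃-wellFounded)
open import Data.Vec using (_∷_; []; here; there)
open import Data.Product using (∃-syntax; _×_; _,_; map₁; map₂)
open import Data.Sum using (inj₁; inj₂)
open import Function.Bundles using (_⇔_; mk⇔; Equivalence)
open import Function.Base using (case_of_)
open import Function.Definitions using (Injective)
open import Relation.Binary.PropositionalEquality
  using (_≡_; refl; sym; trans; cong; cong₂; module ≡-Reasoning)
open import Relation.Nullary using (Dec; yes; no; ¬_; contradiction)
open import Relation.Nullary.Decidable using (map′; _×-dec_; _→-dec_)
open import Relation.Unary using (Decidable)

_⇔-dec_ : ∀ {A B : Set} → Dec A → Dec B → Dec (A ⇔ B)
a? ⇔-dec b? = map′ (λ (to , from) → mk⇔ to from)
                   (λ e → Equivalence.to e , Equivalence.from e)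
                   ((a? →-dec b?) ×-dec (b? →-dec a?))

∣p∪q∣+∣p∩q∣≡∣p∣+∣q∣ : ∀ {n} (p q : Subset n) → ∣ p ∪ q ∣ + ∣ p ∩ q ∣ ≡ ∣ p ∣ + ∣ q ∣
∣p∪q∣+∣p∩q∣≡∣p∣+∣q∣ []            []            = refl
∣p∪q∣+∣p∩q∣≡∣p∣+∣q∣ (outside ∷ p) (outside ∷ q) = ∣p∪q∣+∣p∩q∣≡∣p∣+∣q∣ p q
∣p∪q∣+∣p∩q∣≡∣p∣+∣q∣ (inside  ∷ p) (outside ∷ q) = cong suc (∣p∪q∣+∣p∩q∣≡∣p∣+∣q∣ p q)
∣p∪q∣+∣p∩q∣≡∣p∣+∣q∣ (outside ∷ p) (inside  ∷ q)
  rewrite +-suc ∣ p ∣ ∣ q ∣ = cong suc (∣p∪q∣+∣p∩q∣≡∣p∣+∣q∣ p q)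
∣p∪q∣+∣p∩q∣≡∣p∣+∣q∣ (inside  ∷ p) (inside  ∷ q)
  rewrite +-suc ∣ p ∪ q ∣ ∣ p ∩ q ∣ | +-suc ∣ p ∣ ∣ q ∣ =
  cong (λ k → suc (suc k)) (∣p∪q∣+∣p∩q∣≡∣p∣+∣q∣ p q)

∣p∩p′∣≤∣q∩q′∣⇒∣q∪q′∣≤∣p∪p′∣ : ∀ {m n} (p p′ : Subset m) (q q′ : Subset n) →
  ∣ p ∣ ≡ ∣ q ∣ → ∣ p′ ∣ ≡ ∣ q′ ∣ → ∣ p ∩ p′ ∣ ≤ ∣ q ∩ q′ ∣ → ∣ q ∪ q′ ∣ ≤ ∣ p ∪ p′ ∣
∣p∩p′∣≤∣q∩q′∣⇒∣q∪q′∣≤∣p∪p′∣ p p′ q q′ ∣p∣≡∣q∣ ∣p′∣≡∣q′∣ ∩≤ =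
  +-cancelʳ-≤ ∣ q ∩ q′ ∣ _ _ (begin
    ∣ q ∪ q′ ∣ + ∣ q ∩ q′ ∣  ≡⟨ ∣p∪q∣+∣p∩q∣≡∣p∣+∣q∣ q q′ ⟩
    ∣ q ∣ + ∣ q′ ∣           ≡⟨ cong₂ _+_ ∣p∣≡∣q∣ ∣p′∣≡∣q′∣ ⟨
    ∣ p ∣ + ∣ p′ ∣           ≡⟨ ∣p∪q∣+∣p∩q∣≡∣p∣+∣q∣ p p′ ⟨
    ∣ p ∪ p′ ∣ + ∣ p ∩ p′ ∣  ≤⟨ +-monoʳ-≤ ∣ p ∪ p′ ∣ ∩≤ ⟩
    ∣ p ∪ p′ ∣ + ∣ q ∩ q′ ∣  ∎)
  where open ≤-Reasoning

⊆∧⊄⇒≡ : ∀ {n} {p q : Subset n} → p ⊆ q → ¬ (p ⊂ q) → p ≡ q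
⊆∧⊄⇒≡ {p = p} {q} p⊆q p⊄q = ⊆-antisym p⊆q q⊆p
  where
  q⊆p : q ⊆ p
  q⊆p {x} x∈q with x ∈? p
  ... | yes x∈p = x∈p
  ... | no  x∉p = contradiction ((λ {y} → p⊆q {y}) , x , x∈q , x∉p) p⊄q

injection-tail : ∀ {m n} {f : Fin (suc m) → Fin n} → Injective _≡_ _≡_ f →
                 ∀ {s} {p : Subset m} {q : Subset n} →
                 (∀ {i} → i ∈ s ∷ p → f i ∈ q) → ∣ p ∣ ≤ ∣ q - f Fin.zero ∣

injection⇒∣p∣≤∣q∣ : ∀ {m n} {f : Fin m → Fin n} → Injective _≡_ _≡_ f →
                    ∀ {p : Subset m} {q : Subset n} →
                    (∀ {i} → i ∈ p → f i ∈ q) → ∣ p ∣ ≤ ∣ q ∣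
injection⇒∣p∣≤∣q∣ _ {[]} _ = z≤n
injection⇒∣p∣≤∣q∣ f-inj {inside ∷ p} {q} fp⊆q =
  ≤-trans (s≤s (injection-tail f-inj fp⊆q)) (x∈p⇒∣p-x∣<∣p∣ (fp⊆q here))
injection⇒∣p∣≤∣q∣ f-inj {outside ∷ p} {q} fp⊆q =
  ≤-trans (injection-tail f-inj fp⊆q) (∣p─q∣≤∣p∣ q _)

injection-tail {f = f} f-inj {q = q} fp⊆q =
  injection⇒∣p∣≤∣q∣ (λ e → suc-injective (f-inj e)) λ i∈p →
    x∈p∧x≢y⇒x∈p-y {p = q} {y = f Fin.zero} (fp⊆q (there i∈p)) (λ e → case f-inj e of λ ())

Maximal : ∀ {n} → (Subset n → Set) → Subset n → Set
Maximal P C = P C × (∀ C′ → P C′ → ¬ (C ⊂ C′))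

module _ {n} {P : Subset n → Set} where

  maximal-above : ∀ {C} → Decidable P → Acc _⊃_ C → P C → ∃[ M ] Maximal P M
  maximal-above {C} P? (acc rs) pC with anySubset? (λ C′ → P? C′ ×-dec (C ⊂? C′))
  ... | yes (C′ , pC′ , C⊂C′) = maximal-above P? (rs C⊂C′) pC′
  ... | no  ∄C′               = C , pC , λ C′ pC′ C⊂C′ → ∄C′ (C′ , pC′ , C⊂C′)

  maximal-exists : ∀ {C} → Decidable P → P C → ∃[ M ] Maximal P M
  maximal-exists P? = maximal-above P? (⊃-wellFounded _)

  maximal-unique : (∀ {C₁ C₂} → P C₁ → P C₂ → P (C₁ ∪ C₂)) →
                   ∀ {C₁ C₂} → Maximal P C₁ → Maximal P C₂ → C₁ ≡ C₂
  maximal-unique ∪-closed {C₁} {C₂} (p₁ , max₁) (p₂ , max₂) = begin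
    C₁       ≡⟨ absorbs p₁ max₁ p₂ ⟩
    C₁ ∪ C₂  ≡⟨ ∪-comm C₁ C₂ ⟩
    C₂ ∪ C₁  ≡⟨ absorbs p₂ max₂ p₁ ⟨
    C₂       ∎
    where
    open ≡-Reasoning
    absorbs : ∀ {C C′} → P C → (∀ C″ → P C″ → ¬ (C ⊂ C″)) → P C′ → C ≡ C ∪ C′
    absorbs {C} {C′} pC maxC pC′ =
      ⊆∧⊄⇒≡ (p⊆p∪q C′) (maxC (C ∪ C′) (∪-closed pC pC′))

module _ {m n} (B : BipGraph m n) where

  IsNbhd₁? : ∀ U C → Dec (IsNbhd₁ B U C)
  IsNbhd₁? U C = all? λ j →
    (j ∈? C) ⇔-dec (any? λ i → (i ∈? U) ×-dec (adj B i j Bool.≟ true))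

  Essential₂? : Decidable (Essential₂ B)
  Essential₂? C = anySubset? λ U → (∣ U ∣ ≟ ∣ C ∣) ×-dec IsNbhd₁? U C

  ⊥-essential₂ : Essential₂ B ⊥
  ⊥-essential₂ = ⊥ , trans (∣⊥∣≡0 m) (sym (∣⊥∣≡0 n)) ,
    λ j → mk⇔ (λ j∈⊥ → contradiction j∈⊥ ∉⊥) (λ (_ , i∈⊥ , _) → contradiction i∈⊥ ∉⊥)

  IsNbhd₁-∪ : ∀ {U₁ U₂ C₁ C₂} → IsNbhd₁ B U₁ C₁ → IsNbhd₁ B U₂ C₂ →
              IsNbhd₁ B (U₁ ∪ U₂) (C₁ ∪ C₂)
  IsNbhd₁-∪ {U₁} {U₂} {C₁} {C₂} N₁ N₂ j = mk⇔ to from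
    where
    to : j ∈ C₁ ∪ C₂ → ∃[ i ] (i ∈ U₁ ∪ U₂ × Adj B i j)
    to j∈C with x∈p∪q⁻ C₁ C₂ j∈C
    ... | inj₁ j∈C₁ = map₂ (map₁ (p⊆p∪q U₂)) (Equivalence.to (N₁ j) j∈C₁)
    ... | inj₂ j∈C₂ = map₂ (map₁ (q⊆p∪q U₁ U₂)) (Equivalence.to (N₂ j) j∈C₂)
    from : ∃[ i ] (i ∈ U₁ ∪ U₂ × Adj B i j) → j ∈ C₁ ∪ C₂
    from (i , i∈U , i~j) with x∈p∪q⁻ U₁ U₂ i∈U
    ... | inj₁ i∈U₁ = p⊆p∪q C₂ (Equivalence.from (N₁ j) (i , i∈U₁ , i~j))
    ... | inj₂ i∈U₂ = q⊆p∪q C₁ C₂ (Equivalence.from (N₂ j) (i , i∈U₂ , i~j))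

  module _ (f : Fin m → Fin n) (f-inj : Injective _≡_ _≡_ f)
           (f-adj : ∀ i → Adj B i (f i)) where

    IsNbhd₁⇒matched∈ : ∀ {U C} → IsNbhd₁ B U C → ∀ {i} → i ∈ U → f i ∈ C
    IsNbhd₁⇒matched∈ N {i} i∈U = Equivalence.from (N (f i)) (i , i∈U , f-adj i)

    essential₂-∪ : ∀ {C₁ C₂} → Essential₂ B C₁ → Essential₂ B C₂ → Essential₂ B (C₁ ∪ C₂)
    essential₂-∪ {C₁} {C₂} (U₁ , ∣U₁∣≡∣C₁∣ , N₁) (U₂ , ∣U₂∣≡∣C₂∣ , N₂) =
      U₁ ∪ U₂ , ≤-antisym ∣U∪∣≤∣C∪∣ ∣C∪∣≤∣U∪∣ , N
      where
      N : IsNbhd₁ B (U₁ ∪ U₂) (C₁ ∪ C₂)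
      N = IsNbhd₁-∪ N₁ N₂
      ∣U∪∣≤∣C∪∣ : ∣ U₁ ∪ U₂ ∣ ≤ ∣ C₁ ∪ C₂ ∣
      ∣U∪∣≤∣C∪∣ = injection⇒∣p∣≤∣q∣ f-inj (IsNbhd₁⇒matched∈ N)
      ∣U∩∣≤∣C∩∣ : ∣ U₁ ∩ U₂ ∣ ≤ ∣ C₁ ∩ C₂ ∣
      ∣U∩∣≤∣C∩∣ = injection⇒∣p∣≤∣q∣ f-inj λ i∈U₁∩U₂ →
        let (i∈U₁ , i∈U₂) = x∈p∩q⁻ U₁ U₂ i∈U₁∩U₂
        in x∈p∩q⁺ (IsNbhd₁⇒matched∈ N₁ i∈U₁ , IsNbhd₁⇒matched∈ N₂ i∈U₂)
      ∣C∪∣≤∣U∪∣ : ∣ C₁ ∪ C₂ ∣ ≤ ∣ U₁ ∪ U₂ ∣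
      ∣C∪∣≤∣U∪∣ = ∣p∩p′∣≤∣q∩q′∣⇒∣q∪q′∣≤∣p∪p′∣ U₁ U₂ C₁ C₂
        ∣U₁∣≡∣C₁∣ ∣U₂∣≡∣C₂∣ ∣U∩∣≤∣C∩∣

lemma3p2 : ∀ {r w} (B : BipGraph r w) → HasMatchingSaturating₁ B →
    ∃[ C ] (MaximalEssential₂ B C × (∀ (C′ : Subset w) → MaximalEssential₂ B C′ → C′ ≡ C))
lemma3p2 B (f , f-inj , f-adj) =
  let (C , C-max) = maximal-exists (Essential₂? B) (⊥-essential₂ B)
  in C , C-max , λ C′ C′-max → maximal-unique (essential₂-∪ B f f-inj f-adj) C′-max C-max
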